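{- For all natural numbers $p$ and $q$, $\mathcal{R}_1(p,q,1)=p+q-1$. In particular, for every natural number $n$, $\mathcal{R}_1(n,1)=2n-1$.
   Context: $T_n=n(n+1)/2$, $T_0=0$. A finite set $X\subseteq\mathbb{N}$ with $|X|=T_n$, enumerated $x_1<\dots<x_{T_n}$, has $i$-th level $\{x_{T_{i-1}+1},\dots,x_{T_i}\}$ for $1\le i\le n$; $\triangle_n$ is the set of all such sets. For such sets, $X\le Y$ means $X\subseteq Y$ and every level of $X$ is contained in a single level of $Y$, distinct levels of $X$ being contained in distinct levels of $Y$; $\triangle_k(B)=\{Z\in\triangle_k:Z\le B\}$. For natural numbers $k\le p,q$, a completed game of Mines$_m(p,q,k)$ is a partition $\triangle_k(B)=X\sqcup Y$, where $B\in\triangle_m$; it is a win for player one if there is $Z\in\triangle_p(B)$ with $\triangle_k(Z)\subseteq X$, a win for player two if there is $Z\in\triangle_q(B)$ with $\triangle_k(Z)\subseteq Y$, and a draw otherwise. The triangular Ramsey number $\mathcal{R}_1(p,q,k)$ is the least natural number $m\ge\max(p,q)$ such that no completed game of Mines$_m(p,q,k)$ is a draw; $\mathcal{R}_1(n,k)=\mathcal{R}_1(n,n,k)$. -}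

module Defs where

open import Data.Nat using (ℕ; zero; suc; _+_; _∸_; _*_; _≤_; _<_; _⊔_)
open import Data.Fin using (Fin; toℕ)
open import Data.Bool using (Bool; true; false)
open import Data.List using (List; length; take; drop)
open import Data.List.Relation.Unary.Linked using (Linked)
open import Data.List.Relation.Binary.Subset.Propositional using (_⊆_)
open import Data.Product using (Σ; _×_)
open import Data.Sum using (_⊎_)
open import Relation.Nullary using (¬_)
open import Relation.Binary.PropositionalEquality using (_≡_)
open import Function.Definitions using (Injective)

T : ℕ → ℕ
T zero    = 0
T (suc n) = T n + suc n

-- A finite set X ⊆ ℕ is represented by its increasing enumeration x₁ < … < x_N.
-- Tri n xs : the set enumerated by xs belongs to △_n.
Tri : ℕ → List ℕ → Set
Tri n xs = Linked _<_ xs × length xs ≡ T n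

-- The (j+1)-th level (0-based index j): {x_{T_j + 1}, …, x_{T_{j+1}}}.
level : ℕ → List ℕ → List ℕ
level j xs = take (suc j) (drop (T j) xs)

Le : ℕ → ℕ → List ℕ → List ℕ → Set
Le k m xs ys =
  xs ⊆ ys ×
  Σ (Fin k → Fin m) λ f →
    Injective _≡_ _≡_ f × (∀ i → level (toℕ i) xs ⊆ level (toℕ (f i)) ys)

In△ : ℕ → ℕ → List ℕ → List ℕ → Set
In△ k m B Z = Tri k Z × Le k m Z B

-- A completed game of Mines_m(p,q,k) on B ∈ △_m: the partition
-- △_k(B) = X ⊔ Y is given by a colouring χ, with X = {Z | χ Z = true},
-- Y = {Z | χ Z = false} (restricted to △_k(B)).
WinOne : (p k m : ℕ) → List ℕ → (List ℕ → Bool) → Set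
WinOne p k m B χ =
  Σ (List ℕ) λ Z → In△ p m B Z × (∀ W → In△ k p Z W → χ W ≡ true)

WinTwo : (q k m : ℕ) → List ℕ → (List ℕ → Bool) → Set
WinTwo q k m B χ =
  Σ (List ℕ) λ Z → In△ q m B Z × (∀ W → In△ k q Z W → χ W ≡ false)

IsDraw : (p q k m : ℕ) → List ℕ → (List ℕ → Bool) → Set
IsDraw p q k m B χ = ¬ WinOne p k m B χ × ¬ WinTwo q k m B χ

NoDraw : (p q k m : ℕ) → Set
NoDraw p q k m = ∀ B → Tri m B → (χ : List ℕ → Bool) → ¬ IsDraw p q k m B χ

IsR1 : (p q k r : ℕ) → Set
IsR1 p q k r =
  (p ⊔ q) ≤ r × NoDraw p q k r ×
  (∀ m → (p ⊔ q) ≤ m → m < r → ¬ NoDraw p q k m)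

-- Upper bound: read the levels of B from the top, maintaining a true chain with a levels and a
-- false chain with b levels, a + b = j, built from distinct levels among the first j levels of B.
-- Level j of B has j + 1 = a + b + 1 elements, so it contains a + 1 true or b + 1 false singletons,
-- and these form the next level of the corresponding chain.  After p + q - 1 levels one chain has
-- reached p resp. q levels.
-- Lower bound: in B = {0, …, T m - 1} colour the first p - 1 elements of every level true and the
-- others false.  The top level of a monochromatic Z ∈ △_p(B) or △_q(B) lies inside one level j < m
-- of B, which has only p - 1 true and j + 2 - p ≤ m + 1 - p < q false elements.

module Submission where

open import Defs
open import Data.Nat using (ℕ; zero; suc; _+_; _∸_; _*_; _≤_; _<_; _⊓_; z≤n; s≤s)
open import Data.Nat.Properties
open import Data.Fin using (Fin; toℕ; fromℕ; fromℕ<; inject₁)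
open import Data.Fin.Properties using (toℕ<n; toℕ-fromℕ; toℕ-fromℕ<; toℕ-inject₁)
open import Data.Bool using (Bool; true; false)
open import Data.Bool.Properties using () renaming (_≟_ to _≟ᵇ_)
open import Data.List using (List; []; _∷_; [_]; length; take; drop; _++_; filter)
open import Data.List.Properties using (length-take; length-drop; take-drop; take-all; take-[]; length-++)
open import Data.List.Relation.Unary.Linked using (Linked; []; [-]; _∷_)
open import Data.List.Relation.Unary.Linked.Properties using (AllPairs⇒Linked; Linked⇒AllPairs)
open import Data.List.Relation.Unary.AllPairs using (AllPairs; []; _∷_)
import Data.List.Relation.Unary.AllPairs.Properties as AllPairs
open import Data.List.Relation.Unary.All as All using (All; []; _∷_)
import Data.List.Relation.Unary.All.Properties as All
open import Data.List.Relation.Unary.Any using (here; there)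
open import Data.List.Membership.Propositional using (_∈_)
open import Data.List.Membership.Propositional.Properties using (∈-filter⁻; ∈-++⁻)
open import Data.List.Relation.Binary.Subset.Propositional using (_⊆_)
open import Data.List.Relation.Binary.Subset.Propositional.Properties using (⊆-trans; ++⁺; xs⊆xs++ys)
import Data.List.Relation.Binary.Sublist.Propositional as Sublist
import Data.List.Relation.Binary.Sublist.Propositional.Properties as Sublist
open import Data.Product using (Σ; ∃; _×_; _,_; proj₁; proj₂)
open import Data.Sum using (_⊎_; inj₁; inj₂; [_,_]′)
open import Data.Empty using (⊥-elim)
open import Relation.Nullary using (¬_; Dec; yes; no; does)
open import Relation.Nullary.Decidable using (_×-dec_)
open import Relation.Binary.PropositionalEquality using (_≡_; _≢_; refl; sym; trans; cong; cong₂; subst; module ≡-Reasoning)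
open import Function.Definitions using (Injective)

take-⊆ : ∀ n (xs : List ℕ) → take n xs ⊆ xs
take-⊆ n xs = Sublist.lookup (Sublist.take-⊆ n xs)

drop-⊆ : ∀ n (xs : List ℕ) → drop n xs ⊆ xs
drop-⊆ n xs = Sublist.lookup (Sublist.drop-⊆ n xs)

take-++ˡ : ∀ {n} (xs ys : List ℕ) → n ≤ length xs → take n (xs ++ ys) ≡ take n xs
take-++ˡ {zero}  xs       ys _         = refl
take-++ˡ {suc n} (x ∷ xs) ys (s≤s n≤) = cong (x ∷_) (take-++ˡ xs ys n≤)

drop-length-++ : ∀ (xs ys : List ℕ) → drop (length xs) (xs ++ ys) ≡ ys
drop-length-++ []       ys = refl
drop-length-++ (x ∷ xs) ys = drop-length-++ xs ys

take-+ : ∀ m n (xs : List ℕ) → take (m + n) xs ≡ take m xs ++ take n (drop m xs)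
take-+ zero    n xs       = refl
take-+ (suc m) n []       = sym (take-[] n)
take-+ (suc m) n (x ∷ xs) = cong (x ∷_) (take-+ m n xs)

AllPairs-++-between : ∀ {xs ys x y} → AllPairs _<_ (xs ++ ys) → x ∈ xs → y ∈ ys → x < y
AllPairs-++-between {x′ ∷ xs} (x<ys ∷ _)   (here refl) y∈ = All.lookup (All.++⁻ʳ xs x<ys) y∈
AllPairs-++-between {x′ ∷ xs} (_    ∷ xys) (there x∈)  y∈ = AllPairs-++-between xys x∈ y∈

length≤width : ∀ {lo hi xs} → AllPairs _<_ xs → All (λ x → lo ≤ x × x < hi) xs → length xs ≤ hi ∸ lo
length≤width []                     []                  = z≤n
length≤width {lo} {hi} {x ∷ xs} (x<xs ∷ xs<) ((lo≤x , x<hi) ∷ bounds) = begin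
  suc (length xs)   ≤⟨ s≤s (length≤width xs< (All.zipWith above (x<xs , bounds))) ⟩
  suc (hi ∸ suc x)  ≡⟨ sym (+-∸-assoc 1 x<hi) ⟩
  hi ∸ x            ≤⟨ ∸-monoʳ-≤ hi lo≤x ⟩
  hi ∸ lo           ∎
  where
  open ≤-Reasoning
  above : ∀ {y} → x < y × (lo ≤ y × y < hi) → suc x ≤ y × y < hi
  above (x<y , _ , y<hi) = x<y , y<hi

length-filter-true+false : ∀ (g : ℕ → Bool) xs →
  length (filter (λ x → g x ≟ᵇ true) xs) + length (filter (λ x → g x ≟ᵇ false) xs) ≡ length xs
length-filter-true+false g []       = refl
length-filter-true+false g (x ∷ xs) with g x
... | true  = cong suc (length-filter-true+false g xs)
... | false = trans (+-suc _ _) (cong suc (length-filter-true+false g xs))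

filter-pigeonhole : ∀ (g : ℕ → Bool) {a b} xs → length xs ≡ suc (a + b) →
  a < length (filter (λ x → g x ≟ᵇ true) xs) ⊎ b < length (filter (λ x → g x ≟ᵇ false) xs)
filter-pigeonhole g {a} {b} xs len with a <? length (filter (λ x → g x ≟ᵇ true) xs)
                                 | b <? length (filter (λ x → g x ≟ᵇ false) xs)
... | yes a< | _      = inj₁ a<
... | no _   | yes b< = inj₂ b<
... | no a≮  | no b≮  = ⊥-elim (<-irrefl refl (begin-strict
  a + b                                        <⟨ n<1+n (a + b) ⟩
  suc (a + b)                                  ≡⟨ sym len ⟩
  length xs                                    ≡⟨ sym (length-filter-true+false g xs) ⟩
  length (filter _ xs) + length (filter _ xs)  ≤⟨ +-mono-≤ (≮⇒≥ a≮) (≮⇒≥ b≮) ⟩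
  a + b                                        ∎))
  where open ≤-Reasoning

T-mono-≤ : ∀ {i j} → i ≤ j → T i ≤ T j
T-mono-≤ z≤n       = z≤n
T-mono-≤ (s≤s i≤j) = +-mono-≤ (T-mono-≤ i≤j) (s≤s i≤j)

n≤T[n] : ∀ n → n ≤ T n
n≤T[n] zero    = z≤n
n≤T[n] (suc n) = m≤n+m (suc n) (T n)

T[i]≤w<T[1+j]⇒i≤j : ∀ {i j w} → T i ≤ w → w < T (suc j) → i ≤ j
T[i]≤w<T[1+j]⇒i≤j {i} {j} Ti≤w w<Tj+1 with i ≤? j
... | yes i≤j = i≤j
... | no  i≰j = ⊥-elim (<-irrefl refl (<-≤-trans w<Tj+1 (≤-trans (T-mono-≤ (≰⇒> i≰j)) Ti≤w)))

take-T-suc : ∀ j (xs : List ℕ) → take (T (suc j)) xs ≡ take (T j) xs ++ level j xs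
take-T-suc j xs = take-+ (T j) (suc j) xs

level⊆ : ∀ j (xs : List ℕ) → level j xs ⊆ xs
level⊆ j xs = ⊆-trans (take-⊆ (suc j) (drop (T j) xs)) (drop-⊆ (T j) xs)

level-sorted : ∀ j {xs} → AllPairs _<_ xs → AllPairs _<_ (level j xs)
level-sorted j xs< = AllPairs.take⁺ (suc j) (AllPairs.drop⁺ (T j) xs<)

length-level : ∀ {n j} xs → length xs ≡ T n → j < n → length (level j xs) ≡ suc j
length-level {n} {j} xs len j<n = begin
  length (level j xs)             ≡⟨ length-take (suc j) (drop (T j) xs) ⟩
  suc j ⊓ length (drop (T j) xs)  ≡⟨ cong (suc j ⊓_) (length-drop (T j) xs) ⟩
  suc j ⊓ (length xs ∸ T j)       ≡⟨ m≤n⇒m⊓n≡m room ⟩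
  suc j                           ∎
  where
  open ≡-Reasoning
  room : suc j ≤ length xs ∸ T j
  room = subst (suc j ≤_) (cong (_∸ T j) (sym len))
           (m+n≤o⇒m≤o∸n (suc j) (subst (_≤ T n) (+-comm (T j) (suc j)) (T-mono-≤ j<n)))

level-++ˡ : ∀ {a i} (xs ys : List ℕ) → length xs ≡ T a → i < a → level i (xs ++ ys) ≡ level i xs
level-++ˡ {a} {i} xs ys len i<a = begin
  take (suc i) (drop (T i) (xs ++ ys))      ≡⟨ take-drop (suc i) (T i) (xs ++ ys) ⟩
  drop (T i) (take (T (suc i)) (xs ++ ys))  ≡⟨ cong (drop (T i)) (take-++ˡ xs ys room) ⟩
  drop (T i) (take (T (suc i)) xs)          ≡⟨ take-drop (suc i) (T i) xs ⟨
  take (suc i) (drop (T i) xs)              ∎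
  where
  open ≡-Reasoning
  room : T (suc i) ≤ length xs
  room = subst (T (suc i) ≤_) (sym len) (T-mono-≤ i<a)

level-++ʳ : ∀ {a} (xs ys : List ℕ) → length xs ≡ T a → length ys ≡ suc a → level a (xs ++ ys) ≡ ys
level-++ʳ {a} xs ys lenxs lenys = begin
  take (suc a) (drop (T a) (xs ++ ys))        ≡⟨ cong (λ n → take (suc a) (drop n (xs ++ ys))) (sym lenxs) ⟩
  take (suc a) (drop (length xs) (xs ++ ys))  ≡⟨ cong (take (suc a)) (drop-length-++ xs ys) ⟩
  take (suc a) ys                             ≡⟨ take-all (suc a) ys (≤-reflexive lenys) ⟩
  ys                                          ∎
  where open ≡-Reasoning

△₁-singleton : ∀ {n Z W} → In△ 1 n Z W → ∃ λ w → W ≡ [ w ] × w ∈ Z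
△₁-singleton {W = []}        ((_ , ()) , _)
△₁-singleton {W = w ∷ []}    (_ , W⊆Z , _) = w , refl , W⊆Z (here refl)
△₁-singleton {W = _ ∷ _ ∷ _} ((_ , ()) , _)

singleton-∈△₁ : ∀ {n Z w} (i : Fin n) → w ∈ level (toℕ i) Z → In△ 1 n Z [ w ]
singleton-∈△₁ {Z = Z} i w∈ =
  ([-] , refl) ,
  (λ { (here refl) → level⊆ (toℕ i) Z w∈ }) ,
  (λ _ → i) , (λ { {Fin.zero} {Fin.zero} _ → refl }) , (λ { Fin.zero (here refl) → w∈ })

monochromatic-level : ∀ {r m B Z c} {χ : List ℕ → Bool} → In△ (suc r) m B Z →
  (∀ W → In△ 1 (suc r) Z W → χ W ≡ c) →
  Σ ℕ λ j → j < m × Σ (List ℕ) λ L → AllPairs _<_ L × length L ≡ suc r ×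
    All (λ w → w ∈ level j B × χ [ w ] ≡ c) L
monochromatic-level {r} {Z = Z} ((Z-sorted , Z-length) , _ , f , _ , f-level) coloured =
  toℕ (f top) , toℕ<n (f top) ,
  level r Z , level-sorted r (Linked⇒AllPairs <-trans Z-sorted) ,
  length-level Z Z-length ≤-refl ,
  All.tabulate λ w∈ →
    f-level top (top-level w∈) , coloured [ _ ] (singleton-∈△₁ top (top-level w∈))
  where
  top = fromℕ r
  top-level : ∀ {w} → w ∈ level r Z → w ∈ level (toℕ top) Z
  top-level = subst (λ i → _ ∈ level i Z) (sym (toℕ-fromℕ r))

data SnocView : ∀ {a} → Fin (suc a) → Set where
  old : ∀ {a} (i : Fin a) → SnocView (inject₁ i)
  new : ∀ {a} → SnocView (fromℕ a)

snocView : ∀ {a} (i : Fin (suc a)) → SnocView i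
snocView {zero}  Fin.zero    = new
snocView {suc a} Fin.zero    = old Fin.zero
snocView {suc a} (Fin.suc i) with snocView i
... | old i = old (Fin.suc i)
... | new   = new

snocFin : ∀ {a m} → (Fin a → Fin m) → Fin m → Fin (suc a) → Fin m
snocFin f x i with snocView i
... | old i = f i
... | new   = x

module Greedy {m : ℕ} {B : List ℕ} (B-tri : Tri m B) (χ : List ℕ → Bool) where

  B-sorted : AllPairs _<_ B
  B-sorted = Linked⇒AllPairs <-trans (proj₁ B-tri)

  Win : Bool → ℕ → Set
  Win c p = Σ (List ℕ) λ Z → In△ p m B Z × (∀ W → In△ 1 p Z W → χ W ≡ c)

  coloured? : (c : Bool) (x : ℕ) → Dec (χ [ x ] ≡ c)
  coloured? c x = χ [ x ] ≟ᵇ c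

  record Chain (c : Bool) (a j : ℕ) : Set where
    field
      Z           : List ℕ
      Z-tri       : Tri a Z
      Z-below     : Z ⊆ take (T j) B
      Z-coloured  : ∀ {z} → z ∈ Z → χ [ z ] ≡ c
      f           : Fin a → Fin m
      f-injective : Injective _≡_ _≡_ f
      f-below     : ∀ i → toℕ (f i) < j
      f-level     : ∀ i → level (toℕ i) Z ⊆ level (toℕ (f i)) B

  open Chain

  empty : ∀ {c} → Chain c 0 0
  empty = record
    { Z = [] ; Z-tri = [] , refl ; Z-below = λ () ; Z-coloured = λ ()
    ; f = λ () ; f-injective = λ { {()} } ; f-below = λ () ; f-level = λ () }

  raise : ∀ {c a j} → Chain c a j → Chain c a (suc j)
  raise {j = j} ch = record
    { Z = Z ch ; Z-tri = Z-tri ch ; Z-coloured = Z-coloured ch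
    ; Z-below = λ z∈ → subst (_ ∈_) (sym (take-T-suc j B)) (xs⊆xs++ys _ _ (Z-below ch z∈))
    ; f = f ch ; f-injective = f-injective ch ; f-level = f-level ch
    ; f-below = λ i → m<n⇒m<1+n (f-below ch i) }

  snoc : ∀ {c a j} → Chain c a j → j < m → (C : List ℕ) → AllPairs _<_ C → length C ≡ suc a →
         C ⊆ level j B → (∀ {z} → z ∈ C → χ [ z ] ≡ c) → Chain c (suc a) (suc j)
  snoc {c} {a} {j} ch j<m C C-sorted C-length C⊆ C-coloured = record
    { Z           = Z ch ++ C
    ; Z-tri       = AllPairs⇒Linked (AllPairs.++⁺ Z-sorted C-sorted Z<C)
                  , trans (length-++ (Z ch)) (cong₂ _+_ Z-length C-length)
    ; Z-below     = subst (_ ⊆_) (sym (take-T-suc j B)) (++⁺ (Z-below ch) C⊆)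
    ; Z-coloured  = λ z∈ → [ Z-coloured ch , C-coloured ]′ (∈-++⁻ (Z ch) z∈)
    ; f           = f′
    ; f-injective = f′-injective
    ; f-below     = f′-below
    ; f-level     = f′-level }
    where
    Z-sorted : AllPairs _<_ (Z ch)
    Z-sorted = Linked⇒AllPairs <-trans (proj₁ (Z-tri ch))
    Z-length : length (Z ch) ≡ T a
    Z-length = proj₂ (Z-tri ch)
    below-sorted : AllPairs _<_ (take (T j) B ++ level j B)
    below-sorted = subst (AllPairs _<_) (take-T-suc j B) (AllPairs.take⁺ (T (suc j)) B-sorted)
    Z<C : All (λ z → All (z <_) C) (Z ch)
    Z<C = All.tabulate λ z∈ → All.tabulate λ y∈ →
            AllPairs-++-between below-sorted (Z-below ch z∈) (C⊆ y∈)
    j′ : Fin m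
    j′ = fromℕ< j<m
    f′ : Fin (suc a) → Fin m
    f′ = snocFin (f ch) j′
    f′-below : ∀ i → toℕ (f′ i) < suc j
    f′-below i with snocView i
    ... | old i = m<n⇒m<1+n (f-below ch i)
    ... | new   = s≤s (≤-reflexive (toℕ-fromℕ< j<m))
    old≢new : ∀ i → f ch i ≢ j′
    old≢new i eq = <-irrefl (trans (cong toℕ eq) (toℕ-fromℕ< j<m)) (f-below ch i)
    f′-injective : Injective _≡_ _≡_ f′
    f′-injective {i} {i′} eq with snocView i | snocView i′
    ... | old i | old i′ = cong inject₁ (f-injective ch eq)
    ... | old i | new    = ⊥-elim (old≢new i eq)
    ... | new   | old i′ = ⊥-elim (old≢new i′ (sym eq))
    ... | new   | new    = refl
    f′-level : ∀ i → level (toℕ i) (Z ch ++ C) ⊆ level (toℕ (f′ i)) B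
    f′-level i with snocView i
    ... | old i rewrite toℕ-inject₁ i | level-++ˡ (Z ch) C Z-length (toℕ<n i) = f-level ch i
    ... | new   rewrite toℕ-fromℕ a | toℕ-fromℕ< j<m | level-++ʳ (Z ch) C Z-length C-length = C⊆

  grow : ∀ {c a j} → Chain c a j → j < m → a < length (filter (coloured? c) (level j B)) →
         Chain c (suc a) (suc j)
  grow {c} {a} {j} ch j<m a< =
    snoc ch j<m (take (suc a) F)
      (AllPairs.take⁺ (suc a) (AllPairs.filter⁺ (coloured? c) (level-sorted j B-sorted)))
      (trans (length-take (suc a) F) (m≤n⇒m⊓n≡m a<))
      (λ z∈ → proj₁ (∈-filter⁻ (coloured? c) {xs = level j B} (take-⊆ (suc a) F z∈)))
      (λ z∈ → proj₂ (∈-filter⁻ (coloured? c) {xs = level j B} (take-⊆ (suc a) F z∈)))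
    where
    F = filter (coloured? c) (level j B)

  win : ∀ {c p j} → Chain c p j → Win c p
  win ch = Z ch
         , (Z-tri ch , ⊆-trans (Z-below ch) (take-⊆ _ B) , f ch , f-injective ch , f-level ch)
         , coloured
    where
    coloured : ∀ W → In△ 1 _ (Z ch) W → χ W ≡ _
    coloured W W∈ with △₁-singleton W∈
    ... | w , refl , w∈ = Z-coloured ch w∈

  greedy : ∀ {p q} → p + q ≤ suc m → ∀ r {a b j} → a + b ≡ j → j + r ≡ m → a < p → b < q →
           Chain true a j → Chain false b j → Win true p ⊎ Win false q
  greedy {p} {q} bound zero {a} {b} {j} a+b≡j j+0≡m a<p b<q _ _ =
    ⊥-elim (<-irrefl refl (begin-strict
      suc (a + b)      <⟨ s≤s (≤-reflexive (sym (+-suc a b))) ⟩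
      suc a + suc b    ≤⟨ +-mono-≤ a<p b<q ⟩
      p + q            ≤⟨ bound ⟩
      suc m            ≡⟨ cong suc (trans (sym j+0≡m) (trans (+-identityʳ j) (sym a+b≡j))) ⟩
      suc (a + b)      ∎))
    where open ≤-Reasoning
  greedy {p} {q} bound (suc r) {a} {b} {j} a+b≡j j+r≡m a<p b<q chT chF =
    [ growTrue , growFalse ]′ (filter-pigeonhole (λ x → χ [ x ]) (level j B) level-length)
    where
    j<m : j < m
    j<m = subst (j <_) j+r≡m (m<m+n j (s≤s z≤n))
    level-length : length (level j B) ≡ suc (a + b)
    level-length = trans (length-level B (proj₂ B-tri) j<m) (cong suc (sym a+b≡j))
    1+j+r≡m : suc j + r ≡ m
    1+j+r≡m = trans (sym (+-suc j r)) j+r≡m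
    growTrue : a < length (filter (coloured? true) (level j B)) → Win true p ⊎ Win false q
    growTrue a< with m≤n⇒m<n∨m≡n a<p
    ... | inj₂ refl  = inj₁ (win (grow chT j<m a<))
    ... | inj₁ 1+a<p = greedy bound r (cong suc a+b≡j) 1+j+r≡m 1+a<p b<q (grow chT j<m a<) (raise chF)
    growFalse : b < length (filter (coloured? false) (level j B)) → Win true p ⊎ Win false q
    growFalse b< with m≤n⇒m<n∨m≡n b<q
    ... | inj₂ refl  = inj₂ (win (grow chF j<m b<))
    ... | inj₁ 1+b<q = greedy bound r (trans (+-suc a b) (cong suc a+b≡j)) 1+j+r≡m a<p 1+b<q
                         (raise chT) (grow chF j<m b<)

noDraw : ∀ {p q m} → 1 ≤ p → 1 ≤ q → p + q ≤ suc m → NoDraw p q 1 m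
noDraw {m = m} 1≤p 1≤q bound B B-tri χ (¬winOne , ¬winTwo)
  with greedy bound m {0} {0} {0} refl refl 1≤p 1≤q empty empty
  where open Greedy {m} {B} B-tri χ
... | inj₁ winOne = ¬winOne winOne
... | inj₂ winTwo = ¬winTwo winTwo

interval : ℕ → ℕ → List ℕ
interval a zero    = []
interval a (suc n) = a ∷ interval (suc a) n

length-interval : ∀ a n → length (interval a n) ≡ n
length-interval a zero    = refl
length-interval a (suc n) = cong suc (length-interval (suc a) n)

interval-sorted : ∀ a n → Linked _<_ (interval a n)
interval-sorted a zero          = []
interval-sorted a (suc zero)    = [-]
interval-sorted a (suc (suc n)) = ≤-refl ∷ interval-sorted (suc a) (suc n)

drop-interval : ∀ d a n → drop d (interval a n) ≡ interval (a + d) (n ∸ d)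
drop-interval zero    a n       = cong (λ b → interval b n) (sym (+-identityʳ a))
drop-interval (suc d) a zero    = refl
drop-interval (suc d) a (suc n) =
  trans (drop-interval d (suc a) n) (cong (λ b → interval b (n ∸ d)) (sym (+-suc a d)))

∈-take-interval : ∀ k a n {x} → x ∈ take k (interval a n) → a ≤ x × x < a + k
∈-take-interval (suc k) a (suc n) (here refl) = ≤-refl , m<m+n a (s≤s z≤n)
∈-take-interval (suc k) a (suc n) {x} (there x∈) with ∈-take-interval k (suc a) n x∈
... | a<x , x<1+a+k = <⇒≤ a<x , subst (x <_) (sym (+-suc a k)) x<1+a+k

∈-level-interval : ∀ j N {x} → x ∈ level j (interval 0 N) → T j ≤ x × x < T (suc j)
∈-level-interval j N x∈ =
  ∈-take-interval (suc j) (T j) (N ∸ T j)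
    (subst (λ l → _ ∈ take (suc j) l) (drop-interval (T j) 0 N) x∈)

module Colouring (p′ : ℕ) where

  -- early? w holds iff w is among the first p′ elements of its level; only singletons are coloured.
  early? : (w : ℕ) → Dec (∃ λ j → j < suc w × T j ≤ w × w < T j + p′)
  early? w = anyUpTo? (λ j → T j ≤? w ×-dec w <? T j + p′) (suc w)

  colour : List ℕ → Bool
  colour []      = true
  colour (w ∷ _) = does (early? w)

  colour-true : ∀ {j w} → T j ≤ w → w < T (suc j) → colour [ w ] ≡ true → w < T j + p′
  colour-true {j} {w} _ w<T[1+j] eq with early? w
  ... | yes (i , _ , Ti≤w , w<Ti+p′) =
    <-≤-trans w<Ti+p′ (+-monoˡ-≤ p′ (T-mono-≤ (T[i]≤w<T[1+j]⇒i≤j {i} {j} Ti≤w w<T[1+j])))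

  colour-false : ∀ {j w} → T j ≤ w → colour [ w ] ≡ false → T j + p′ ≤ w
  colour-false {j} {w} Tj≤w eq with T j + p′ ≤? w | early? w
  ... | yes Tj+p′≤w | _        = Tj+p′≤w
  ... | no  Tj+p′≰w | no ¬early =
    ⊥-elim (¬early (j , s≤s (≤-trans (n≤T[n] j) Tj≤w) , Tj≤w , ≰⇒> Tj+p′≰w))

draw : ∀ {p q m} → 1 ≤ p → 1 ≤ q → suc m < p + q → ¬ NoDraw p q 1 m
draw {suc p′} {suc q′} {m} _ _ (s≤s m<p′+1+q′) noDraw =
  noDraw B (interval-sorted 0 (T m) , length-interval 0 (T m)) colour (¬winOne , ¬winTwo)
  where
  open Colouring p′
  B = interval 0 (T m)
  ¬winOne : ¬ WinOne (suc p′) 1 m B colour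
  ¬winOne (Z , Z∈ , coloured) with monochromatic-level Z∈ coloured
  ... | j , _ , L , L-sorted , L-length , L-early = 1+n≰n (begin
    suc p′              ≡⟨ sym L-length ⟩
    length L            ≤⟨ length≤width L-sorted (All.map bounds L-early) ⟩
    (T j + p′) ∸ T j    ≡⟨ m+n∸m≡n (T j) p′ ⟩
    p′                  ∎)
    where
    open ≤-Reasoning
    bounds : ∀ {w} → w ∈ level j B × colour [ w ] ≡ true → T j ≤ w × w < T j + p′
    bounds (w∈ , eq) with ∈-level-interval j (T m) w∈
    ... | Tj≤w , w<T[1+j] = Tj≤w , colour-true {j} Tj≤w w<T[1+j] eq
  ¬winTwo : ¬ WinTwo (suc q′) 1 m B colour
  ¬winTwo (Z , Z∈ , coloured) with monochromatic-level Z∈ coloured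
  ... | j , j<m , L , L-sorted , L-length , L-late = <-irrefl refl (begin-strict
    suc q′                          ≡⟨ sym L-length ⟩
    length L                        ≤⟨ length≤width L-sorted (All.map bounds L-late) ⟩
    (T j + suc j) ∸ (T j + p′)      ≡⟨ [m+n]∸[m+o]≡n∸o (T j) (suc j) p′ ⟩
    suc j ∸ p′                      ≤⟨ ∸-monoˡ-≤ p′ j<m ⟩
    m ∸ p′                          <⟨ m<n+o⇒m∸n<o m p′ m<p′+1+q′ ⟩
    suc q′                          ∎)
    where
    open ≤-Reasoning
    bounds : ∀ {w} → w ∈ level j B × colour [ w ] ≡ false → T j + p′ ≤ w × w < T j + suc j
    bounds (w∈ , eq) with ∈-level-interval j (T m) w∈
    ... | Tj≤w , w<T[1+j] = colour-false {j} Tj≤w eq , w<T[1+j]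

isR1 : ∀ p q → 1 ≤ p → 1 ≤ q → IsR1 p q 1 (p + q ∸ 1)
isR1 (suc p′) (suc q′) 1≤p 1≤q =
  ⊔-lub (subst (suc p′ ≤_) (sym (+-suc p′ q′)) (m≤m+n (suc p′) q′)) (m≤n+m (suc q′) p′) ,
  noDraw 1≤p 1≤q ≤-refl ,
  λ m _ m<p+q∸1 → draw 1≤p 1≤q (s≤s m<p+q∸1)

theorem6 : ((p q : ℕ) → 1 ≤ p → 1 ≤ q → IsR1 p q 1 (p + q ∸ 1))
    × ((n : ℕ) → 1 ≤ n → IsR1 n n 1 (2 * n ∸ 1))
theorem6 = isR1 , λ n 1≤n →
  subst (λ n+n → IsR1 n n 1 (n + n+n ∸ 1)) (sym (+-identityʳ n)) (isR1 n n 1≤n 1≤n)
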